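{- Let $\alpha:\mathbb{A}^\Delta\to(H,V)$ be a morphism into a finite forest algebra and $k<k'$ integers. If $\alpha$ is closed under $k$-saturation then $\alpha$ is closed under $k'$-saturation.
   Context: $\mathbb{A}=(A,B)$ finite alphabet ($A$ leaf labels, $B$ inner labels). Trees/forests: each $a\in A$ is a tree; $t_1+\dots+t_k$ ($k\ge1$ trees) is a forest; $b(s)$ is a tree for $b\in B$ and a forest $s$. A context is a forest over $(A\cup\{\square\},B)$ with exactly one leaf labelled $\square$ (the port), not a root and without siblings; its backbone is the set of strict ancestors of the port. A multicontext is like a context with any number of ports (its arity). A forest algebra $(H,V)$: finite semigroups ($H$ additive, $V$ multiplicative) with a left action $V\times H\to H$, $w(vh)=(wv)h$, and for all $g,v$ elements $v+g,g+v\in V$ with $(v+g)h=vh+g$, $(g+v)h=g+vh$; $\mathbb{A}^\Delta$ is the free forest algebra of forests and contexts; morphisms are compatible pairs of semigroup morphisms. $\omega$ is a positive integer with $x^\omega$ idempotent for all $x\in V$. Sibling patterns: multicontexts each of whose trees is $a$, $b(\square)$ or $b(a)$, excluding single trees $a\in A$; viewed as strings over the letters $a,b(\square),b(a)$; $b$ is the inner label. The sibling pattern of a node $x$ in a forest: with $t_1+\dots+t_\ell$ the subtrees rooted at siblings of $x$ (including $x$), it is $p_1+\dots+p_\ell$, $p_i=a$ if $t_i=a$, $b(a)$ if $t_i=b(a)$, $b(\square)$ if $t_i=b(s')$ with $s'$ not a single leaf. For a set $P$ of sibling patterns: a forest (context) is $P$-valid if it has more than one node and all its sibling patterns are in $P$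 (a node whose only child is the port contributes $b(\square)$); elements of $H$/$V$ are $P$-valid if images of $P$-valid forests/contexts; $h$ is $P$-reachable from $h'$ if $h=vh'$ for a $P$-valid $v$. $P$ is branching if it contains a pattern of arity $\ge 2$; then there is a unique maximal class $H_P$ of mutually $P$-reachable $P$-valid forest types; $P$ is reduced if branching and all $P$-valid forest types lie in $H_P$. Relaxed game: for $X\subseteq H$, nodes labelled $b(\square)$ are port-nodes, $b(a)$ with $\alpha(a)\in X$ are $X$-nodes, others non-$X$-nodes. The $k$-round $X$-relaxed game on $(p,x),(p',x')$ starts with pebbles on $x,x'$; each round Spoiler either moves a pebble to a node $z$ strictly left or right and Duplicator moves the other in the same direction to $z'$ with the label of $z$ if $z$ is non-$X$, otherwise a port-node or $X$-node with the same inner label; or, when pebbles are on nodes labelled $b(c),b(c')$ with $c\neq c'\in A\cup\{\square\}$, Spoiler selects a pebble (safety move) and Duplicator must put the other on a node labelled $b(\square)$. $(p,x)\equiv_k^X(p',x')$ iff same letters in $p,p'$, same label at $x,x'$, and Duplicator wins. Saturation: for branching reduced $P$, a context $\Delta$ is $(P,k)$-saturated if it is $P$-valid and for each port-node $x$ of each $p\in P$ there is a port-node $x'$ on the backbone of $\Delta$ with sibling pattern $p'$ such that $(p,x)\equiv_k^{H_P}(p',x')$. $\alpha$ is closed under $k$-saturation if for every branching reduced $P$, every $(P,k)$-saturated $\Delta$ and all $h_1,h_2\in H_P$: $\alpha(\Delta)^\omega h_1=\alpha(\Delta)^\omega h_2$. -}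

module Defs where

open import Data.Nat using (ℕ; zero; suc; _≤_; _≡ᵇ_)
import Data.Nat as N
open import Data.Fin using (Fin; toℕ)
open import Data.Bool using (Bool; true; false; _∧_; T)
open import Data.Maybe using (Maybe; just; nothing)
open import Data.List using (List; []; _∷_; length; lookup)
open import Data.List.Membership.Propositional using (_∈_)
open import Data.Product using (Σ; ∃; _×_; _,_; proj₁)
open import Data.Sum using (_⊎_)
open import Data.Unit using (⊤)
open import Data.Empty using (⊥)
open import Relation.Nullary using (¬_)
open import Relation.Binary.PropositionalEquality using (_≡_)
open import Function.Bundles using (_↔_)

mutual
  data Tree (B L : Set) : Set where
    leaf : L → Tree B L
    node : B → Forest B L → Tree B L

  data Forest (B L : Set) : Set where
    [_] : Tree B L → Forest B L
    _∷_ : Tree B L → Forest B L → Forest B L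

infixr 5 _++F_
_++F_ : ∀ {B L} → Forest B L → Forest B L → Forest B L
[ t ] ++F s = t ∷ s
(t ∷ r) ++F s = t ∷ (r ++F s)

toListF : ∀ {B L} → Forest B L → List (Tree B L)
toListF [ t ] = t ∷ []
toListF (t ∷ s) = t ∷ toListF s

mutual
  bindT : ∀ {B L L'} → Tree B L → (L → Forest B L') → Forest B L'
  bindT (leaf l) f = f l
  bindT (node b s) f = [ node b (bindF s f) ]

  bindF : ∀ {B L L'} → Forest B L → (L → Forest B L') → Forest B L'
  bindF [ t ] f = bindT t f
  bindF (t ∷ s) f = bindT t f ++F bindF s f

-- number of nodes (ports included)
mutual
  sizeT : ∀ {B L} → Tree B L → ℕ
  sizeT (leaf _) = 1
  sizeT (node _ s) = suc (sizeF s)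

  sizeF : ∀ {B L} → Forest B L → ℕ
  sizeF [ t ] = sizeT t
  sizeF (t ∷ s) = sizeT t N.+ sizeF s

-- Contexts: forests over (A ∪ {□}, B), the port □ being  nothing.

mutual
  portsT : ∀ {B A} → Tree B (Maybe A) → ℕ
  portsT (leaf nothing) = 1
  portsT (leaf (just _)) = 0
  portsT (node _ s) = portsF s

  portsF : ∀ {B A} → Forest B (Maybe A) → ℕ
  portsF [ t ] = portsT t
  portsF (t ∷ s) = portsT t N.+ portsF s

-- every port is not a root and has no siblings
mutual
  okT : ∀ {B A} → Tree B (Maybe A) → Bool
  okT (leaf (just _)) = true
  okT (leaf nothing) = false
  okT (node _ [ leaf nothing ]) = true
  okT (node _ s) = okF s

  okF : ∀ {B A} → Forest B (Maybe A) → Bool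
  okF [ t ] = okT t
  okF (t ∷ s) = okT t ∧ okF s

isCtx : ∀ {B A} → Forest B (Maybe A) → Bool
isCtx Δ = okF Δ ∧ (portsF Δ ≡ᵇ 1)

Ctx : (A B : Set) → Set
Ctx A B = Σ (Forest B (Maybe A)) (λ Δ → T (isCtx Δ))

emb : ∀ {B A} → Forest B A → Forest B (Maybe A)
emb s = bindF s (λ a → [ leaf (just a) ])

plug : ∀ {B A} → Forest B (Maybe A) → Forest B A → Forest B A
plug Δ s = bindF Δ (λ { nothing → s ; (just a) → [ leaf a ] })

compose : ∀ {B A} → Forest B (Maybe A) → Forest B (Maybe A) → Forest B (Maybe A)
compose Δ Δ' = bindF Δ (λ { nothing → Δ' ; (just a) → [ leaf (just a) ] })

record ForestAlgebra : Set₁ where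
  infixl 6 _+_
  infixl 7 _·_
  infixr 5 _∙_
  field
    H V : Set
    _+_ : H → H → H
    _·_ : V → V → V
    _∙_ : V → H → H
    _⊕ʳ_ : V → H → V
    _⊕ˡ_ : H → V → V
    +-assoc : ∀ x y z → (x + y) + z ≡ x + (y + z)
    ·-assoc : ∀ x y z → (x · y) · z ≡ x · (y · z)
    act-assoc : ∀ w v h → w ∙ (v ∙ h) ≡ (w · v) ∙ h
    ⊕ʳ-act : ∀ v g h → (v ⊕ʳ g) ∙ h ≡ (v ∙ h) + g
    ⊕ˡ-act : ∀ g v h → (g ⊕ˡ v) ∙ h ≡ g + (v ∙ h)
    H-finite : Σ ℕ (λ n → H ↔ Fin n)
    V-finite : Σ ℕ (λ n → V ↔ Fin n)

-- v ^ n for n ≥ 1 (the value at n = 0 is irrelevant, we set it to v)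
_^_ : {FA : ForestAlgebra} → ForestAlgebra.V FA → ℕ → ForestAlgebra.V FA
_^_ v zero = v
_^_ v (suc zero) = v
_^_ {FA} v (suc (suc n)) = ForestAlgebra._·_ FA v (_^_ {FA} v (suc n))

record Morphism (A B : Set) (FA : ForestAlgebra) : Set where
  open ForestAlgebra FA
  field
    αH : Forest B A → H
    αV : Ctx A B → V
    pres-+ : ∀ s t → αH (s ++F t) ≡ αH s + αH t
    pres-· : ∀ (Δ Δ' : Ctx A B) (p : T (isCtx (compose (proj₁ Δ) (proj₁ Δ')))) →
             αV (compose (proj₁ Δ) (proj₁ Δ') , p) ≡ αV Δ · αV Δ'
    pres-act : ∀ (Δ : Ctx A B) s → αH (plug (proj₁ Δ) s) ≡ αV Δ ∙ αH s

-- Sibling patterns, as strings of letters  a , b(□) , b(a)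

data Letter (A B : Set) : Set where
  lf : A → Letter A B
  pt : B → Letter A B
  bl : B → A → Letter A B

IsSibPat : ∀ {A B} → List (Letter A B) → Set
IsSibPat [] = ⊥
IsSibPat (lf _ ∷ []) = ⊥
IsSibPat (_ ∷ _) = ⊤

arity : ∀ {A B} → List (Letter A B) → ℕ
arity [] = 0
arity (pt _ ∷ w) = suc (arity w)
arity (lf _ ∷ w) = arity w
arity (bl _ _ ∷ w) = arity w

letterT : ∀ {A B} → Tree B (Maybe A) → Maybe (Letter A B)
letterT (leaf (just a)) = just (lf a)
letterT (leaf nothing) = nothing
letterT (node b [ leaf (just a) ]) = just (bl b a)
letterT (node b _) = just (pt b)

mapLetters : ∀ {A B} → List (Tree B (Maybe A)) → Maybe (List (Letter A B))
mapLetters [] = just []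
mapLetters (t ∷ ts) with letterT t | mapLetters ts
... | just l | just w = just (l ∷ w)
... | _ | _ = nothing

pat : ∀ {A B} → Forest B (Maybe A) → Maybe (List (Letter A B))
pat s = mapLetters (toListF s)

SibSet : (A B : Set) → Set₁
SibSet A B = List (Letter A B) → Set

-- all sibling patterns of a forest lie in P (groups consisting of a
-- single leaf child, i.e. a leaf a or the port under b, are encoded
-- by the parent's letter b(a) / b(□))
mutual
  SibOKF : ∀ {A B} → SibSet A B → Forest B (Maybe A) → Set
  SibOKF P s = (∃ λ w → pat s ≡ just w × P w) × ChildrenOK P s

  ChildrenOK : ∀ {A B} → SibSet A B → Forest B (Maybe A) → Set
  ChildrenOK P [ t ] = ChildOK P t
  ChildrenOK P (t ∷ s) = ChildOK P t × ChildrenOK P s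

  ChildOK : ∀ {A B} → SibSet A B → Tree B (Maybe A) → Set
  ChildOK P (leaf _) = ⊤
  ChildOK P (node _ [ leaf _ ]) = ⊤
  ChildOK P (node _ s) = SibOKF P s

PValidF : ∀ {A B} → SibSet A B → Forest B A → Set
PValidF P s = 2 ≤ sizeF (emb s) × SibOKF P (emb s)

PValidC : ∀ {A B} → SibSet A B → Ctx A B → Set
PValidC P (Δ , _) = 2 ≤ sizeF Δ × SibOKF P Δ

Branching : ∀ {A B} → SibSet A B → Set
Branching P = ∃ λ w → P w × 2 ≤ arity w

module _ {A B : Set} {FA : ForestAlgebra} (α : Morphism A B FA) where
  open ForestAlgebra FA
  open Morphism α

  ValidH : SibSet A B → H → Set
  ValidH P h = ∃ λ s → PValidF P s × αH s ≡ h

  ValidV : SibSet A B → V → Set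
  ValidV P v = ∃ λ Δ → PValidC P Δ × αV Δ ≡ v

  Reach : SibSet A B → H → H → Set
  Reach P h h' = ∃ λ v → ValidV P v × h ≡ v ∙ h'

  -- X is the maximal class of mutually P-reachable P-valid forest types
  IsHP : SibSet A B → (H → Set) → Set
  IsHP P X =
      (∀ h → X h → ValidH P h)
    × (∃ λ h → X h)
    × (∀ h h' → X h → X h' → h ≡ h' ⊎ (Reach P h h' × Reach P h' h))
    × (∀ h h' → X h → ValidH P h' → Reach P h' h → X h')

  Reduced : SibSet A B → (H → Set) → Set
  Reduced P X = Branching P × (∀ h → ValidH P h → X h)

  PortOrX : (H → Set) → Letter A B → Set
  PortOrX X (lf _) = ⊥
  PortOrX X (pt _) = ⊤
  PortOrX X (bl _ a) = X (αH [ leaf a ])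

  inner : Letter A B → Maybe B
  inner (lf _) = nothing
  inner (pt b) = just b
  inner (bl b _) = just b

  body : Letter A B → Maybe (B × Maybe A)
  body (lf _) = nothing
  body (pt b) = just (b , nothing)
  body (bl b a) = just (b , just a)

  -- Duplicator answers a node labelled l by a node labelled l'
  Resp : (H → Set) → Letter A B → Letter A B → Set
  Resp X l l' = (¬ PortOrX X l → l' ≡ l)
              × (PortOrX X l → PortOrX X l' × inner l' ≡ inner l)

  Word = List (Letter A B)

  Win : (H → Set) → ℕ → (w : Word) → Fin (length w) → (w' : Word) → Fin (length w') → Set
  Win X zero w i w' i' = ⊤
  Win X (suc k) w i w' i' =
      -- Spoiler moves the first pebble left / right
      (∀ z → toℕ z N.< toℕ i → ∃ λ z' → toℕ z' N.< toℕ i'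
             × Resp X (lookup w z) (lookup w' z') × Win X k w z w' z')
    × (∀ z → toℕ i N.< toℕ z → ∃ λ z' → toℕ i' N.< toℕ z'
             × Resp X (lookup w z) (lookup w' z') × Win X k w z w' z')
      -- Spoiler moves the second pebble left / right
    × (∀ z' → toℕ z' N.< toℕ i' → ∃ λ z → toℕ z N.< toℕ i
             × Resp X (lookup w' z') (lookup w z) × Win X k w z w' z')
    × (∀ z' → toℕ i' N.< toℕ z' → ∃ λ z → toℕ i N.< toℕ z
             × Resp X (lookup w' z') (lookup w z) × Win X k w z w' z')
      -- safety moves
    × (∀ b c c' → body (lookup w i) ≡ just (b , c) → body (lookup w' i') ≡ just (b , c')
             → ¬ c ≡ c'
             → (∃ λ z' → lookup w' z' ≡ pt b × Win X k w i w' z')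
             × (∃ λ z → lookup w z ≡ pt b × Win X k w z w' i'))

  GameEquiv : (H → Set) → ℕ → (w : Word) → Fin (length w) → (w' : Word) → Fin (length w') → Set
  GameEquiv X k w i w' i' =
      (∀ l → (l ∈ w → l ∈ w') × (l ∈ w' → l ∈ w))
    × lookup w i ≡ lookup w' i'
    × Win X k w i w' i'

  IsPort : Letter A B → Set
  IsPort (pt _) = ⊤
  IsPort _ = ⊥

  nth : ∀ {C : Set} → List C → ℕ → Maybe C
  nth [] _ = nothing
  nth (x ∷ _) zero = just x
  nth (_ ∷ xs) (suc n) = nth xs n

  -- OnBackbone Δ w i : the i-th node (0-based) of a sibling group of Δ
  -- with pattern w is a (strict) ancestor of the port
  data OnBackbone : Forest B (Maybe A) → Word → ℕ → Set where
    here : ∀ {Δ w} i t → nth (toListF Δ) i ≡ just t → 1 ≤ portsT t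
           → pat Δ ≡ just w → OnBackbone Δ w i
    there : ∀ {Δ w i b s} → node b s ∈ toListF Δ → OnBackbone s w i
            → OnBackbone Δ w i

  Saturated : SibSet A B → (H → Set) → ℕ → Ctx A B → Set
  Saturated P X k Δ =
      PValidC P Δ
    × (∀ w → P w → ∀ (x : Fin (length w)) → IsPort (lookup w x)
         → ∃ λ w' → Σ (Fin (length w')) λ x' →
             OnBackbone (proj₁ Δ) w' (toℕ x') × IsPort (lookup w' x')
             × GameEquiv X k w x w' x')

  ClosedUnderSat : ℕ → ℕ → Set₁
  ClosedUnderSat ω k =
    ∀ (P : SibSet A B) → (∀ w → P w → IsSibPat w) →
    ∀ (X : H → Set) → IsHP P X → Reduced P X →
    ∀ (Δ : Ctx A B) → Saturated P X k Δ →
    ∀ h₁ h₂ → X h₁ → X h₂ →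
    (_^_ {FA} (αV Δ) ω) ∙ h₁ ≡ (_^_ {FA} (αV Δ) ω) ∙ h₂

module Submission where

-- The k-round relaxed game only gets harder for Duplicator as k grows:
-- a winning strategy for k' rounds, truncated after k ≤ k' rounds, is a
-- winning strategy for k rounds (`win-antitone`).  Hence game
-- equivalence for k' rounds implies it for k rounds
-- (`gameEquiv-antitone`), so every (P,k')-saturated context is also
-- (P,k)-saturated (`saturated-antitone`).  Closure under k-saturation
-- quantifies over the (P,k)-saturated contexts, a larger class than the
-- (P,k')-saturated ones, so it implies closure under k'-saturation
-- (`closedUnderSat-mono`).

open import Defs
open import Data.Nat using (ℕ; _≤_; _<_; zero; suc; s≤s)
open import Data.Nat.Properties using (<⇒≤)
open import Data.Fin using (Fin)
open import Data.Product using (∃; _×_; _,_; map₂)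
open import Relation.Binary.PropositionalEquality using (_≡_)

module _ {A B : Set} {FA : ForestAlgebra} (α : Morphism A B FA) where

  weaken-answer : ∀ {C : Set} {Q : C → Set} {W W′ : C → Set} →
                  (∀ {z} → W z → W′ z) →
                  (∃ λ z → Q z × W z) → (∃ λ z → Q z × W′ z)
  weaken-answer f = map₂ (map₂ f)

  win-antitone : ∀ X {k k'} → k ≤ k' → ∀ {w i w' i'} →
                 Win α X k' w i w' i' → Win α X k w i w' i'
  win-antitone X {zero} _ _ = _
  win-antitone X {suc k} {suc k'} (s≤s k≤k') (left , right , left' , right' , safety) =
      (λ z p → weaken-answer (map₂ down) (left z p))
    , (λ z p → weaken-answer (map₂ down) (right z p))
    , (λ z' p → weaken-answer (map₂ down) (left' z' p))
    , (λ z' p → weaken-answer (map₂ down) (right' z' p))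
    , (λ b c c' e e' c≢c' →
         let (answer , answer') = safety b c c' e e' c≢c'
         in weaken-answer down answer , weaken-answer down answer')
    where
    down : ∀ {w i w' i'} → Win α X k' w i w' i' → Win α X k w i w' i'
    down = win-antitone X k≤k'

  gameEquiv-antitone : ∀ X {k k'} → k ≤ k' → ∀ {w i w' i'} →
                       GameEquiv α X k' w i w' i' → GameEquiv α X k w i w' i'
  gameEquiv-antitone X k≤k' = map₂ (map₂ (win-antitone X k≤k'))

  saturated-antitone : ∀ P X {k k'} → k ≤ k' → ∀ {Δ} →
                       Saturated α P X k' Δ → Saturated α P X k Δ
  saturated-antitone P X k≤k' (valid , witnesses) =
      valid
    , λ w pw x port → map₂ (map₂ (map₂ (map₂ (gameEquiv-antitone X k≤k'))))
                           (witnesses w pw x port)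

  closedUnderSat-mono : ∀ ω {k k'} → k ≤ k' →
                        ClosedUnderSat α ω k → ClosedUnderSat α ω k'
  closedUnderSat-mono ω k≤k' closed P sib X hp red Δ sat =
    closed P sib X hp red Δ (saturated-antitone P X k≤k' {Δ} sat)

lemma6p1 : ∀ (m n : ℕ) (FA : ForestAlgebra) (α : Morphism (Fin m) (Fin n) FA)
    (ω : ℕ) → 1 ≤ ω →
    (∀ v → ForestAlgebra._·_ FA (_^_ {FA} v ω) (_^_ {FA} v ω) ≡ _^_ {FA} v ω) →
    ∀ k k' → k < k' →
    ClosedUnderSat α ω k → ClosedUnderSat α ω k'
lemma6p1 m n FA α ω _ _ k k' k<k' = closedUnderSat-mono α ω (<⇒≤ k<k')
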